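{- Let $F$ be a graph with chromatic number $3$ that has a color-critical vertex, and let $C_{2k+1}$ be the longest odd cycle such that some blow-up of $C_{2k+1}$ contains $F$ as a subgraph. Then $F$ is a subgraph of a blow-up of $C_{2k+1}$ in which one of the blown-up classes has exactly one vertex.
   Context: A blow-up of a graph $G$ is obtained by replacing each vertex $v_i$ with a non-empty independent set $V_i$ (the blown-up class) and each edge $v_iv_j$ with all edges between $V_i$ and $V_j$. A vertex of $F$ is color-critical if deleting it decreases the chromatic number. -}

module Defs where

open import Data.Nat using (ℕ; zero; suc; _+_; _*_; _<_; _%_)
open import Data.Fin using (Fin; toℕ; punchIn)
open import Data.Product using (Σ; _×_; ∃-syntax; proj₁)
open import Data.Sum using (_⊎_)
open import Data.Empty using (⊥)
open import Relation.Nullary using (¬_)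
open import Relation.Binary.PropositionalEquality using (_≡_; _≢_)
open import Function.Definitions using (Injective)

record Graph (V : Set) : Set₁ where
  field
    Adj    : V → V → Set
    sym    : ∀ {u v} → Adj u v → Adj v u
    irrefl : ∀ {v} → ¬ Adj v v
open Graph public

Colorable : ∀ {n} → Graph (Fin n) → ℕ → Set
Colorable {n} F k =
  Σ (Fin n → Fin k) λ c → ∀ {u v} → Adj F u v → c u ≢ c v

HasChromaticNumber : ∀ {n} → Graph (Fin n) → ℕ → Set
HasChromaticNumber F k = Colorable F k × (∀ j → j < k → ¬ Colorable F j)

deleteVertex : ∀ {n} → Graph (Fin (suc n)) → Fin (suc n) → Graph (Fin n)
deleteVertex F v = record
  { Adj    = λ i j → Adj F (punchIn v i) (punchIn v j)
  ; sym    = sym F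
  ; irrefl = irrefl F
  }

ColorCritical : ∀ {n} → Graph (Fin (suc n)) → Fin (suc n) → Set
ColorCritical F v =
  ∃[ k ] (HasChromaticNumber F k × ∃[ j ] (j < k × HasChromaticNumber (deleteVertex F v) j))

-- Adjacency of the cycle C_m on vertices 0..m-1 (i ~ i+1 mod m), m = suc m'.
CycleAdj : (m' : ℕ) → Fin (suc m') → Fin (suc m') → Set
CycleAdj m' i j = (toℕ j ≡ suc (toℕ i) % suc m') ⊎ (toℕ i ≡ suc (toℕ j) % suc m')

BlowUpV : (m' : ℕ) → (Fin (suc m') → ℕ) → Set
BlowUpV m' s = Σ (Fin (suc m')) λ i → Fin (s i)

-- Adjacency in the blow-up: complete bipartite between classes of adjacent cycle vertices.
BlowUpAdj : (m' : ℕ) (s : Fin (suc m') → ℕ) → BlowUpV m' s → BlowUpV m' s → Set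
BlowUpAdj m' s x y = CycleAdj m' (proj₁ x) (proj₁ y)

-- F is a (not necessarily induced) subgraph of a host graph given by its adjacency relation:
-- an injective map of vertices preserving edges.
SubgraphOf : ∀ {n} {W : Set} → Graph (Fin n) → (W → W → Set) → Set
SubgraphOf {n} {W} F HAdj =
  Σ (Fin n → W) λ f → Injective _≡_ _≡_ f × (∀ {u v} → Adj F u v → HAdj (f u) (f v))

InBlowUpWith : ∀ {n} → Graph (Fin n) → (k : ℕ) → (Fin (suc (2 * k)) → ℕ) → Set
InBlowUpWith F k s = (∀ i → 0 < s i) × SubgraphOf F (BlowUpAdj (2 * k) s)

InSomeBlowUp : ∀ {n} → Graph (Fin n) → ℕ → Set
InSomeBlowUp F k = ∃[ s ] InBlowUpWith F k s

{-# OPTIONS --safe #-}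
-- Let h : F → C_{2k+1} be the homomorphism underlying the blow-up, rotated so that h v = 0, and
-- let c be a proper 2-colouring of F − v, which exists because v is colour-critical in a
-- 3-chromatic graph. For u ≠ v the pair (h u, c u) moves along C_{2k+1} × K₂, a single cycle of
-- length 4k+2. Folding that cycle twice onto the path 1, …, 2k of C_{2k+1} − 0, keeping the
-- neighbours 1 and 2k of 0 at the ends, gives a homomorphism F → C_{2k+1} under which only v is
-- sent to 0; so blowing 0 up to one vertex and every other cycle vertex to |V(F)| vertices yields
-- a blow-up containing F.
module Submission where

open import Defs hiding (sym)
open import Data.Nat using (ℕ; zero; suc; _+_; _*_; _∸_; _%_; _<_; _≤_; z≤n; s≤s; NonZero; parity)
open import Data.Nat.Properties using (≤-trans; ≤-pred; ≮⇒≥; *-monoʳ-≤; <⇒≤; m≤n⇒m<n∨m≡n; +-comm; +-∸-assoc; m+n∸n≡m; m+[n∸m]≡n; ∸-monoʳ-<; m<n⇒0<n∸m; m∸n≤m; m<n⇒n≢0)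
open import Data.Nat.DivMod using (m<n⇒m%n≡m; n%n≡0; m%n<n; %-distribˡ-+; m%n%n≡m%n)
open import Data.Parity.Base using (Parity; 0ℙ; 1ℙ; _⁻¹) renaming (_+_ to _+ℙ_)
open import Data.Parity.Properties using (⁻¹-involutive; ⁻¹-selfInverse; suc-homo-⁻¹; *-homo-*)
open import Data.Fin using (Fin; zero; suc; toℕ; fromℕ<; inject≤; punchIn; punchOut; _≟_)
open import Data.Fin.Properties using (toℕ-fromℕ<; toℕ<n; toℕ-injective; inject≤-injective; punchIn-punchOut)
open import Data.Product using (_×_; ∃-syntax; _,_; proj₁; proj₂; Σ)
open import Data.Sum using (_⊎_; inj₁; inj₂)
open import Data.Empty using (⊥-elim)
open import Relation.Nullary using (¬_; yes; no)
open import Relation.Binary.PropositionalEquality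

-- CycleAdj m i j unfolds to CycleAdjℕ m (toℕ i) (toℕ j).
CycleAdjℕ : ℕ → ℕ → ℕ → Set
CycleAdjℕ m x y = (y ≡ suc x % suc m) ⊎ (x ≡ suc y % suc m)

cycleAdj-sym : ∀ {m x y} → CycleAdjℕ m x y → CycleAdjℕ m y x
cycleAdj-sym (inj₁ p) = inj₂ p
cycleAdj-sym (inj₂ p) = inj₁ p

data CycleStep (m : ℕ) : ℕ → ℕ → Set where
  inner : ∀ {x} → x < m → CycleStep m x (suc x)
  wrap  : CycleStep m m 0

cycleStep⇒cycleAdj : ∀ {m x y} → CycleStep m x y → CycleAdjℕ m x y
cycleStep⇒cycleAdj (inner x<m) = inj₁ (sym (m<n⇒m%n≡m (s≤s x<m)))
cycleStep⇒cycleAdj {m} wrap    = inj₁ (sym (n%n≡0 (suc m)))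

suc%⇒cycleStep : ∀ {m x y} → x < suc m → y ≡ suc x % suc m → CycleStep m x y
suc%⇒cycleStep {m} {x} (s≤s x≤m) refl with m≤n⇒m<n∨m≡n x≤m
... | inj₁ x<m rewrite m<n⇒m%n≡m (s≤s x<m) = inner x<m
... | inj₂ refl = subst (CycleStep m m) (sym (n%n≡0 (suc m))) wrap

%-absorbˡ : ∀ x d N .{{_ : NonZero N}} → (x % N + d) % N ≡ (x + d) % N
%-absorbˡ x d N = begin
  (x % N + d) % N          ≡⟨ %-distribˡ-+ (x % N) d N ⟩
  (x % N % N + d % N) % N  ≡⟨ cong (λ t → (t + d % N) % N) (m%n%n≡m%n x N) ⟩
  (x % N + d % N) % N      ≡⟨ sym (%-distribˡ-+ x d N) ⟩
  (x + d) % N              ∎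
  where open ≡-Reasoning

%-absorbʳ : ∀ d x N .{{_ : NonZero N}} → (d + x % N) % N ≡ (d + x) % N
%-absorbʳ d x N = begin
  (d + x % N) % N  ≡⟨ cong (_% N) (+-comm d (x % N)) ⟩
  (x % N + d) % N  ≡⟨ %-absorbˡ x d N ⟩
  (x + d) % N      ≡⟨ cong (_% N) (+-comm x d) ⟩
  (d + x) % N      ∎
  where open ≡-Reasoning

cycleAdj-rotate : ∀ {m x y} d → CycleAdjℕ m x y → CycleAdjℕ m ((x + d) % suc m) ((y + d) % suc m)
cycleAdj-rotate {m} {x} d (inj₁ refl) =
  inj₁ (trans (%-absorbˡ (suc x) d (suc m)) (sym (%-absorbʳ 1 (x + d) (suc m))))
cycleAdj-rotate {m} {y = y} d (inj₂ refl) =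
  inj₂ (trans (%-absorbˡ (suc y) d (suc m)) (sym (%-absorbʳ 1 (y + d) (suc m))))

rotate : ∀ {m} → ℕ → Fin (suc m) → Fin (suc m)
rotate {m} d i = fromℕ< (m%n<n (toℕ i + d) (suc m))

toℕ-rotate : ∀ {m} d (i : Fin (suc m)) → toℕ (rotate d i) ≡ (toℕ i + d) % suc m
toℕ-rotate d i = toℕ-fromℕ< _

rotate-adj : ∀ {m} d {i j : Fin (suc m)} → CycleAdj m i j → CycleAdj m (rotate d i) (rotate d j)
rotate-adj {m} d {i} {j} e =
  subst₂ (CycleAdjℕ m) (sym (toℕ-rotate d i)) (sym (toℕ-rotate d j)) (cycleAdj-rotate d e)

rotate-to-zero : ∀ {m} (i : Fin (suc m)) → rotate (suc m ∸ toℕ i) i ≡ zero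
rotate-to-zero {m} i = toℕ-injective (begin
  toℕ (rotate (suc m ∸ toℕ i) i)    ≡⟨ toℕ-rotate (suc m ∸ toℕ i) i ⟩
  (toℕ i + (suc m ∸ toℕ i)) % suc m ≡⟨ cong (_% suc m) (m+[n∸m]≡n (<⇒≤ (toℕ<n i))) ⟩
  suc m % suc m                     ≡⟨ n%n≡0 (suc m) ⟩
  0                                 ∎)
  where open ≡-Reasoning

parity-suc-+-⁻¹ : ∀ a q → parity (suc a) +ℙ q ⁻¹ ≡ parity a +ℙ q
parity-suc-+-⁻¹ a q = begin
  parity (suc a) +ℙ q ⁻¹    ≡⟨ cong (_+ℙ q ⁻¹) (sym (⁻¹-selfInverse (suc-homo-⁻¹ a))) ⟩
  parity a ⁻¹ +ℙ q ⁻¹       ≡⟨ ⁻¹-+-⁻¹ (parity a) q ⟩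
  parity a +ℙ q             ∎
  where
  open ≡-Reasoning
  ⁻¹-+-⁻¹ : ∀ p q → p ⁻¹ +ℙ q ⁻¹ ≡ p +ℙ q
  ⁻¹-+-⁻¹ 0ℙ 0ℙ = refl
  ⁻¹-+-⁻¹ 0ℙ 1ℙ = refl
  ⁻¹-+-⁻¹ 1ℙ 0ℙ = refl
  ⁻¹-+-⁻¹ 1ℙ 1ℙ = refl

module Fold (m : ℕ) (1<m : 1 < m) (m-even : parity m ≡ 0ℙ) where

  nudge : ℕ → ℕ
  nudge zero    = 2
  nudge (suc a) = suc a

  orient : Parity → ℕ → ℕ
  orient 0ℙ x = x
  orient 1ℙ x = suc m ∸ x

  -- Along an edge of C_{m+1} × K₂ the parity parity a + q is constant except across the wrap
  -- m → 0, so fold traces the closed walk 2, 1, 2, 3, …, m, m−1, m, m−1, …, 2, 1 in C_{m+1} − 0.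
  fold : ℕ → Parity → ℕ
  fold a q = orient (parity a +ℙ q) (nudge a)

  nudge-range : ∀ {a} → a ≤ m → 0 < nudge a × nudge a ≤ m
  nudge-range {zero}  _   = s≤s z≤n , 1<m
  nudge-range {suc a} a≤m = s≤s z≤n , a≤m

  orient-range : ∀ q {x} → 0 < x → x ≤ m → 0 < orient q x × orient q x ≤ m
  orient-range 0ℙ 0<x x≤m = 0<x , x≤m
  orient-range 1ℙ {suc x} _ x<m = m<n⇒0<n∸m x<m , m∸n≤m m x

  fold-range : ∀ {a} q → a < suc m → 0 < fold a q × fold a q ≤ m
  fold-range {a} q (s≤s a≤m) =
    let (0<x , x≤m) = nudge-range a≤m in orient-range (parity a +ℙ q) 0<x x≤m

  reflect-step : ∀ {x} → 0 < x → x ≤ m → CycleStep m (m ∸ x) (suc m ∸ x)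
  reflect-step {x} 0<x x≤m =
    subst (CycleStep m (m ∸ x)) (sym (+-∸-assoc 1 x≤m)) (inner (∸-monoʳ-< 0<x x≤m))

  orient-nudge-step : ∀ p {a} → a < m → CycleAdjℕ m (orient p (nudge a)) (orient p (suc a))
  orient-nudge-step 0ℙ {zero}  _   = cycleAdj-sym {m} (cycleStep⇒cycleAdj (inner 1<m))
  orient-nudge-step 0ℙ {suc a} a<m = cycleStep⇒cycleAdj (inner a<m)
  orient-nudge-step 1ℙ {zero}  _   = cycleStep⇒cycleAdj (reflect-step (s≤s z≤n) (<⇒≤ 1<m))
  orient-nudge-step 1ℙ {suc a} a<m =
    cycleAdj-sym {m} (cycleStep⇒cycleAdj (reflect-step (s≤s z≤n) (<⇒≤ a<m)))

  fold-inner : ∀ {a} q → a < m → CycleAdjℕ m (fold a q) (fold (suc a) (q ⁻¹))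
  fold-inner {a} q a<m =
    subst (λ p → CycleAdjℕ m (fold a q) (orient p (suc a)))
          (sym (parity-suc-+-⁻¹ a q))
          (orient-nudge-step (parity a +ℙ q) a<m)

  fold-m : ∀ q → fold m q ≡ orient q m
  fold-m q = cong₂ orient (cong (_+ℙ q) m-even) (nudge-id (<⇒≤ 1<m))
    where
    nudge-id : ∀ {x} → 0 < x → nudge x ≡ x
    nudge-id (s≤s _) = refl

  orient-m≡1 : orient 1ℙ m ≡ 1
  orient-m≡1 = m+n∸n≡m 1 m

  fold-wrap : ∀ q → CycleAdjℕ m (fold m q) (fold 0 (q ⁻¹))
  fold-wrap q = subst (λ x → CycleAdjℕ m x (fold 0 (q ⁻¹))) (sym (fold-m q)) (orient-wrap q)
    where
    orient-wrap : ∀ q → CycleAdjℕ m (orient q m) (orient (q ⁻¹) 2)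
    orient-wrap 0ℙ = cycleAdj-sym {m} (cycleStep⇒cycleAdj (reflect-step (s≤s z≤n) (<⇒≤ 1<m)))
    orient-wrap 1ℙ = subst (λ x → CycleAdjℕ m x 2) (sym orient-m≡1) (cycleStep⇒cycleAdj (inner 1<m))

  fold-cycleStep : ∀ {a b} → CycleStep m a b → ∀ q → CycleAdjℕ m (fold a q) (fold b (q ⁻¹))
  fold-cycleStep (inner a<m) q = fold-inner q a<m
  fold-cycleStep wrap        q = fold-wrap q

  fold-adj : ∀ {a b} → a < suc m → b < suc m → CycleAdjℕ m a b →
             ∀ q → CycleAdjℕ m (fold a q) (fold b (q ⁻¹))
  fold-adj a<N _   (inj₁ b≡a+1) q = fold-cycleStep (suc%⇒cycleStep a<N b≡a+1) q
  fold-adj {a} {b} _ b<N (inj₂ a≡b+1) q =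
    cycleAdj-sym {m} (subst (λ p → CycleAdjℕ m (fold b (q ⁻¹)) (fold a p)) (⁻¹-involutive q)
                            (fold-cycleStep (suc%⇒cycleStep b<N a≡b+1) (q ⁻¹)))

  fold-near-zero : ∀ {a} → a < suc m → CycleAdjℕ m 0 a → ∀ q → CycleAdjℕ m 0 (fold a q)
  fold-near-zero _ (inj₁ refl) q =
    subst (λ a → CycleAdjℕ m 0 (fold a q)) (sym (m<n⇒m%n≡m (s≤s (<⇒≤ 1<m)))) (orient-1 q)
    where
    orient-1 : ∀ q → CycleAdjℕ m 0 (orient (q ⁻¹) 1)
    orient-1 0ℙ = cycleAdj-sym {m} (cycleStep⇒cycleAdj wrap)
    orient-1 1ℙ = cycleStep⇒cycleAdj (inner (<⇒≤ 1<m))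
  fold-near-zero a<N (inj₂ 0≡a+1) q with suc%⇒cycleStep a<N 0≡a+1
  ... | wrap = subst (CycleAdjℕ m 0) (sym (fold-m q)) (orient-m q)
    where
    orient-m : ∀ q → CycleAdjℕ m 0 (orient q m)
    orient-m 0ℙ = cycleAdj-sym {m} (cycleStep⇒cycleAdj wrap)
    orient-m 1ℙ = subst (CycleAdjℕ m 0) (sym orient-m≡1) (cycleStep⇒cycleAdj (inner (<⇒≤ 1<m)))

  foldFin : Fin (suc m) → Parity → Fin (suc m)
  foldFin i q = fromℕ< (s≤s (proj₂ (fold-range q (toℕ<n i))))

  toℕ-foldFin : ∀ i q → toℕ (foldFin i q) ≡ fold (toℕ i) q
  toℕ-foldFin i q = toℕ-fromℕ< _

  foldFin-adj : ∀ {i j} → CycleAdj m i j → ∀ q → CycleAdj m (foldFin i q) (foldFin j (q ⁻¹))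
  foldFin-adj {i} {j} e q =
    subst₂ (CycleAdjℕ m) (sym (toℕ-foldFin i q)) (sym (toℕ-foldFin j (q ⁻¹)))
           (fold-adj (toℕ<n i) (toℕ<n j) e q)

  foldFin-near-zero : ∀ {i} → CycleAdj m zero i → ∀ q → CycleAdj m zero (foldFin i q)
  foldFin-near-zero {i} e q =
    subst (CycleAdjℕ m 0) (sym (toℕ-foldFin i q)) (fold-near-zero (toℕ<n i) e q)

  foldFin≢zero : ∀ i q → foldFin i q ≢ zero
  foldFin≢zero i q eq =
    m<n⇒n≢0 (proj₁ (fold-range q (toℕ<n i))) (trans (sym (toℕ-foldFin i q)) (cong toℕ eq))

colorable-weaken : ∀ {n} {G : Graph (Fin n)} {j j′} → j ≤ j′ → Colorable G j → Colorable G j′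
colorable-weaken j≤j′ (c , proper) =
  (λ u → inject≤ (c u) j≤j′) , λ e eq → proper e (inject≤-injective j≤j′ j≤j′ _ _ eq)

chromaticNumber-≤ : ∀ {n} {G : Graph (Fin n)} {k j} → HasChromaticNumber G k → Colorable G j → k ≤ j
chromaticNumber-≤ (_ , not-below) c = ≮⇒≥ (λ j<k → not-below _ j<k c)

critical-deletion-2-colorable : ∀ {n} {F : Graph (Fin (suc n))} {v} →
  HasChromaticNumber F 3 → ColorCritical F v → Colorable (deleteVertex F v) 2
critical-deletion-2-colorable {F = F} {v} χ≡3 (_ , χ≡k , j , j<k , (c , _)) =
  colorable-weaken {G = deleteVertex F v} j≤2 c
  where
  j≤2 : j ≤ 2
  j≤2 = ≤-pred (≤-trans j<k (chromaticNumber-≤ {G = F} χ≡k (proj₁ χ≡3)))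

record ParityColouring {n} (G : Graph (Fin n)) : Set where
  constructor parityColouring
  field
    colour : Fin n → Parity
    proper : ∀ {u w} → Adj G u w → colour w ≡ colour u ⁻¹

colorable-2⇒parityColouring : ∀ {n} {G : Graph (Fin n)} → Colorable G 2 → ParityColouring G
colorable-2⇒parityColouring (c , proper) =
  parityColouring (λ u → toParity (c u)) (λ e → toParity-≢ (proper e))
  where
  toParity : Fin 2 → Parity
  toParity zero    = 0ℙ
  toParity (suc _) = 1ℙ

  toParity-≢ : ∀ {x y : Fin 2} → x ≢ y → toParity y ≡ toParity x ⁻¹
  toParity-≢ {zero}     {zero}     x≢y = ⊥-elim (x≢y refl)
  toParity-≢ {zero}     {suc zero} _   = refl
  toParity-≢ {suc zero} {zero}     _   = refl
  toParity-≢ {suc zero} {suc zero} x≢y = ⊥-elim (x≢y refl)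

record CycleHom {n} (F : Graph (Fin n)) (m : ℕ) : Set where
  constructor cycleHom
  field
    position     : Fin n → Fin (suc m)
    position-adj : ∀ {u w} → Adj F u w → CycleAdj m (position u) (position w)
open CycleHom

blowUp⇒cycleHom : ∀ {n m s} {F : Graph (Fin n)} → SubgraphOf F (BlowUpAdj m s) → CycleHom F m
blowUp⇒cycleHom (f , _ , f-adj) = cycleHom (λ u → proj₁ (f u)) f-adj

cycleHom-rotate : ∀ {n m} {F : Graph (Fin n)} → CycleHom F m → ∀ v →
                  Σ (CycleHom F m) λ h → position h v ≡ zero
cycleHom-rotate {m = m} (cycleHom h h-adj) v =
  cycleHom (λ u → rotate d (h u)) (λ e → rotate-adj d (h-adj e)) , rotate-to-zero (h v)
  where
  d : ℕ
  d = suc m ∸ toℕ (h v)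

data Punctured {n} (v : Fin (suc n)) : Fin (suc n) → Set where
  centre  : Punctured v v
  punched : (i : Fin n) → Punctured v (punchIn v i)

punctured : ∀ {n} (v u : Fin (suc n)) → Punctured v u
punctured v u with v ≟ u
... | yes refl = centre
... | no v≢u   = subst (Punctured v) (punchIn-punchOut v≢u) (punched (punchOut v≢u))

cycleHom-isolate : ∀ {n m} (F : Graph (Fin (suc n))) (v : Fin (suc n)) → 1 < m → parity m ≡ 0ℙ →
  (h : CycleHom F m) → position h v ≡ zero → ParityColouring (deleteVertex F v) →
  Σ (CycleHom F m) λ φ → ∀ u → position φ u ≡ zero → u ≡ v
cycleHom-isolate {m = m} F v 1<m m-even (cycleHom h h-adj) hv≡0 (parityColouring c c-proper) =
  cycleHom (λ u → φ (punctured v u)) (λ {u} {w} e → φ-adj (punctured v u) (punctured v w) e) ,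
  λ u → φ-zero (punctured v u)
  where
  open Fold m 1<m m-even

  φ : ∀ {u} → Punctured v u → Fin (suc m)
  φ centre      = zero
  φ (punched i) = foldFin (h (punchIn v i)) (c i)

  h-adj-centre : ∀ {u} → Adj F v u → CycleAdj m zero (h u)
  h-adj-centre {u} e = subst (λ x → CycleAdj m x (h u)) hv≡0 (h-adj e)

  φ-adj : ∀ {u w} (pu : Punctured v u) (pw : Punctured v w) → Adj F u w → CycleAdj m (φ pu) (φ pw)
  φ-adj centre      centre      e = ⊥-elim (irrefl F e)
  φ-adj centre      (punched j) e = foldFin-near-zero (h-adj-centre e) (c j)
  φ-adj (punched i) centre      e =
    cycleAdj-sym {m} (foldFin-near-zero (h-adj-centre (Graph.sym F e)) (c i))
  φ-adj (punched i) (punched j) e =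
    subst (λ q → CycleAdj m (φ (punched i)) (foldFin (h (punchIn v j)) q))
          (sym (c-proper e)) (foldFin-adj (h-adj e) (c i))

  φ-zero : ∀ {u} (pu : Punctured v u) → φ pu ≡ zero → u ≡ v
  φ-zero centre      _  = refl
  φ-zero (punched i) eq = ⊥-elim (foldFin≢zero (h (punchIn v i)) (c i) eq)

cycleHom⇒blowUp-singleton : ∀ {n m} {F : Graph (Fin (suc n))} {v} (h : CycleHom F m) →
  (∀ u → position h u ≡ zero → u ≡ v) →
  ∃[ s ] (((∀ i → 0 < s i) × SubgraphOf F (BlowUpAdj m s)) × s zero ≡ 1)
cycleHom⇒blowUp-singleton {n} {m} {v = v} (cycleHom h h-adj) only-v↦0 =
  sizes , (nonempty , embed , embed-injective , h-adj) , refl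
  where
  sizes : Fin (suc m) → ℕ
  sizes zero    = 1
  sizes (suc _) = suc n

  nonempty : ∀ i → 0 < sizes i
  nonempty zero    = s≤s z≤n
  nonempty (suc _) = s≤s z≤n

  slot : ∀ i → Fin (suc n) → Fin (sizes i)
  slot zero    _ = zero
  slot (suc _) u = u

  embed : Fin (suc n) → BlowUpV m sizes
  embed u = h u , slot (h u) u

  slot-injective : ∀ i j {u w} → (i ≡ zero → u ≡ v) → (j ≡ zero → w ≡ v) →
                   _≡_ {A = BlowUpV m sizes} (i , slot i u) (j , slot j w) → u ≡ w
  slot-injective zero    zero    u≡v w≡v refl = trans (u≡v refl) (sym (w≡v refl))
  slot-injective (suc _) (suc _) _   _   refl = refl

  embed-injective : ∀ {u w} → embed u ≡ embed w → u ≡ w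
  embed-injective {u} {w} = slot-injective (h u) (h w) (only-v↦0 u) (only-v↦0 w)

lemma8 : (n : ℕ) (F : Graph (Fin (suc n))) →
         HasChromaticNumber F 3 →
         (∃[ v ] ColorCritical F v) →
         (k : ℕ) → 1 ≤ k →
         InSomeBlowUp F k →
         (∀ k′ → k < k′ → ¬ InSomeBlowUp F k′) →
         ∃[ s ] (InBlowUpWith F k s × ∃[ i ] (s i ≡ 1))
lemma8 n F χ≡3 (v , v-critical) k 1≤k (_ , _ , F⊆blowUp) _ =
  let (s′ , F⊆blowUp′ , s′₀≡1) = cycleHom⇒blowUp-singleton (proj₁ isolated) (proj₂ isolated)
  in s′ , F⊆blowUp′ , zero , s′₀≡1
  where
  centred : Σ (CycleHom F (2 * k)) λ h → position h v ≡ zero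
  centred = cycleHom-rotate (blowUp⇒cycleHom F⊆blowUp) v

  colouring : ParityColouring (deleteVertex F v)
  colouring = colorable-2⇒parityColouring (critical-deletion-2-colorable {F = F} χ≡3 v-critical)

  isolated : Σ (CycleHom F (2 * k)) λ φ → ∀ u → position φ u ≡ zero → u ≡ v
  isolated = cycleHom-isolate F v (*-monoʳ-≤ 2 1≤k) (*-homo-* 2 k)
                              (proj₁ centred) (proj₂ centred) colouring
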